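{- Let $Q$ be a finite set of primes with $2,3\notin Q$ and $|Q|=4$ such that $$3\cdot \prod_{q\in Q}(q-1) - 2\prod_{q\in Q} q = 2.$$ Then $Q=\{5,7,37,1297\}$, i.e. $n:=\prod_{q\in Q} q = 5\cdot 7\cdot 37\cdot 1297$. Conversely $Q=\{5,7,37,1297\}$ satisfies this equation.
   Context: For a finite set $Q$ of primes, $n=\prod_{q\in Q}q$ is the associated integer. -}

module Defs where

open import Data.Nat using (ℕ; _∸_)
open import Data.Nat.ListAction using (product)
open import Data.List using (List; _∷_; []; map)
open import Data.Integer using (ℤ; +_; _-_; _*_)
open import Relation.Binary.PropositionalEquality using (_≡_)

Q₀ : List ℕ
Q₀ = 5 ∷ 7 ∷ 37 ∷ 1297 ∷ []

prodQ : List ℕ → ℕ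
prodQ Q = product Q

-- ∏_{q∈Q} (q - 1)  (q ≥ 2 for primes, so truncated subtraction is exact)
prodQm1 : List ℕ → ℕ
prodQm1 Q = product (map (λ q → q ∸ 1) Q)

Eqn : List ℕ → Set
Eqn Q = (+ 3) * (+ prodQm1 Q) - (+ 2) * (+ prodQ Q) ≡ + 2

module Submission where

open import Defs
open import Data.Nat using (ℕ; zero; suc; _+_; _*_; _∸_; _^_; _≤_; _<_; z≤n; s≤s; z<s; >-nonZero)
open import Data.Nat.Properties
open import Data.Nat.Primality using (Prime; prime?; ¬prime[0]; ¬prime[1]; composite[4])
open import Data.Nat.ListAction.Properties using (product-↭)
open import Data.Nat.Tactic.RingSolver using (solve-∀)
open import Data.Integer as ℤ using (+_)
import Data.Integer.Properties as ℤ
open import Algebra.Properties.AbelianGroup ℤ.+-0-abelianGroup using (//-rightDividesˡ)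
open import Relation.Binary.PropositionalEquality
open import Relation.Binary.PropositionalEquality.Properties using (setoid)
open import Data.List using (List; []; _∷_; length; map; _++_)
open import Data.List.Relation.Unary.All as All using (All; []; _∷_; all?)
open import Data.List.Relation.Unary.AllPairs as AllPairs using (AllPairs; []; _∷_)
open import Data.List.Relation.Unary.Linked.Properties using (Linked⇒AllPairs)
open import Data.List.Relation.Unary.Unique.Propositional using (Unique)
open import Data.List.Relation.Unary.Unique.DecPropositional _≟_ using (unique?)
open import Data.List.Relation.Unary.Any using (here; there)
open import Data.List.Membership.Propositional using (_∈_; _∉_)
open import Data.List.Membership.DecPropositional _≟_ using (_∈?_)
open import Data.List.Membership.Propositional.Properties using (∈-++⁺ˡ; ∈-++⁺ʳ; ∈-map⁺)
open import Data.List.Relation.Binary.Permutation.Propositional using (_↭_; ↭-sym; ↭⇒↭ₛ)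
open import Data.List.Relation.Binary.Permutation.Propositional.Properties
  using (All-resp-↭; map⁺; ↭-length)
open import Data.List.Relation.Binary.Permutation.Setoid.Properties (setoid ℕ) using (Unique-resp-↭)
open import Data.List.Sort ≤-decTotalOrder using (sort; sort-↭; sort-↗)
open import Data.Maybe as Maybe using (Maybe; just; nothing)
open import Data.Maybe.Relation.Unary.All as MaybeAll using (just; nothing; drop-just)
import Data.Maybe.Relation.Unary.All.Properties as MaybeAll
open import Data.Product using (_×_; _,_)
open import Data.Sum using (_⊎_; inj₁; inj₂)
open import Relation.Nullary using (¬_; Dec; yes; no; contradiction)
open import Relation.Nullary.Decidable using (from-yes; from-no)

-- After sorting, Q is an increasing list of numbers ≥ 5. Fixing a prefix
-- with A = ∏(q - 1) and B = ∏ q over it, the rest R must satisfy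
-- 3 A ∏_R (q - 1) = 2 B ∏_R q + 2.  Then 3A > 2B is forced, and if every
-- entry of R is at least x then ∏_R q/(q - 1) ≤ (x/(x - 1))^|R|, which
-- bounds x.  So the admissible entries can be enumerated one at a time; the
-- enumeration leaves 5·7·37·1297 and 5·7·49·133, and 49 is not prime.

data IncreasingFrom : ℕ → List ℕ → Set where
  []  : ∀ {t} → IncreasingFrom t []
  _∷_ : ∀ {t x xs} → t ≤ x → IncreasingFrom (suc x) xs → IncreasingFrom t (x ∷ xs)

IncreasingFrom⇒All≤ : ∀ {t xs} → IncreasingFrom t xs → All (t ≤_) xs
IncreasingFrom⇒All≤ []           = []
IncreasingFrom⇒All≤ (t≤x ∷ incr) =
  t≤x ∷ All.map (λ x<y → ≤-trans t≤x (<⇒≤ x<y)) (IncreasingFrom⇒All≤ incr)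

AllPairs<⇒IncreasingFrom : ∀ {t xs} → All (t ≤_) xs → AllPairs _<_ xs → IncreasingFrom t xs
AllPairs<⇒IncreasingFrom []          []             = []
AllPairs<⇒IncreasingFrom (t≤x ∷ t≤xs) (x<xs ∷ xs<xs) = t≤x ∷ AllPairs<⇒IncreasingFrom x<xs xs<xs

sort-increasing : ∀ {t} xs → All (t ≤_) xs → Unique xs → IncreasingFrom t (sort xs)
sort-increasing xs t≤xs unique = AllPairs<⇒IncreasingFrom
  (All-resp-↭ (↭-sym (sort-↭ xs)) t≤xs)
  (AllPairs.zipWith (λ (x≤y , x≢y) → ≤∧≢⇒< x≤y x≢y)
    (Linked⇒AllPairs ≤-trans (sort-↗ xs) , Unique-resp-↭ (↭⇒↭ₛ (↭-sym (sort-↭ xs))) unique))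

Solves : ℕ → ℕ → List ℕ → Set
Solves A B R = 3 * A * prodQm1 R ≡ 2 * B * prodQ R + 2

solves? : ∀ A B R → Dec (Solves A B R)
solves? A B R = 3 * A * prodQm1 R ≟ 2 * B * prodQ R + 2

Solves-resp-↭ : ∀ A B {R R′} → R ↭ R′ → Solves A B R → Solves A B R′
Solves-resp-↭ A B R↭R′ sol =
  subst₂ (λ m p → 3 * A * m ≡ 2 * B * p + 2)
    (product-↭ (map⁺ (_∸ 1) R↭R′)) (product-↭ R↭R′) sol

Solves-∷ : ∀ A B x R → Solves A B (x ∷ R) → Solves (A * (x ∸ 1)) (B * x) R
Solves-∷ A B x R sol = begin
  3 * (A * (x ∸ 1)) * prodQm1 R ≡⟨ reassoc 3 A (x ∸ 1) (prodQm1 R) ⟩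
  3 * A * ((x ∸ 1) * prodQm1 R) ≡⟨ sol ⟩
  2 * B * (x * prodQ R) + 2     ≡⟨ cong (_+ 2) (reassoc 2 B x (prodQ R)) ⟨
  2 * (B * x) * prodQ R + 2     ∎
  where
  open ≡-Reasoning
  reassoc : ∀ k a u m → k * (a * u) * m ≡ k * a * (u * m)
  reassoc = solve-∀

prodQm1≤prodQ : ∀ R → prodQm1 R ≤ prodQ R
prodQm1≤prodQ []      = ≤-refl
prodQm1≤prodQ (x ∷ R) = *-mono-≤ (m∸n≤m x 1) (prodQm1≤prodQ R)

3A≤2B⇒¬Solves : ∀ A B R → 3 * A ≤ 2 * B → ¬ Solves A B R
3A≤2B⇒¬Solves A B R 3A≤2B sol = m+1+n≰m (2 * B * prodQ R) (begin
  2 * B * prodQ R + 2  ≡⟨ sol ⟨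
  3 * A * prodQm1 R    ≤⟨ *-mono-≤ 3A≤2B (prodQm1≤prodQ R) ⟩
  2 * B * prodQ R      ∎)
  where open ≤-Reasoning

x^length≤prodQ : ∀ {x R} → All (x ≤_) R → x ^ length R ≤ prodQ R
x^length≤prodQ []          = ≤-refl
x^length≤prodQ (x≤y ∷ x≤R) = *-mono-≤ x≤y (x^length≤prodQ x≤R)

[m∸1]*n≤m*[n∸1] : ∀ {m n} → m ≤ n → (m ∸ 1) * n ≤ m * (n ∸ 1)
[m∸1]*n≤m*[n∸1] {m} {n} m≤n = begin
  (m ∸ 1) * n   ≡⟨ *-distribʳ-∸ n m 1 ⟩
  m * n ∸ 1 * n ≡⟨ cong (m * n ∸_) (*-identityˡ n) ⟩
  m * n ∸ n     ≤⟨ ∸-monoʳ-≤ (m * n) m≤n ⟩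
  m * n ∸ m     ≡⟨ cong (m * n ∸_) (*-identityʳ m) ⟨
  m * n ∸ m * 1 ≡⟨ *-distribˡ-∸ m n 1 ⟨
  m * (n ∸ 1)   ∎
  where open ≤-Reasoning

-- The ratio bound ∏ q/(q - 1) ≤ (x/(x - 1))^|R|, cleared of denominators.
[x∸1]^length*prodQ≤x^length*prodQm1 : ∀ {x R} → All (x ≤_) R →
  (x ∸ 1) ^ length R * prodQ R ≤ x ^ length R * prodQm1 R
[x∸1]^length*prodQ≤x^length*prodQm1 []                        = ≤-refl
[x∸1]^length*prodQ≤x^length*prodQm1 {x} {y ∷ R} (x≤y ∷ x≤R) = begin
  (x ∸ 1) * (x ∸ 1) ^ length R * (y * prodQ R)
    ≡⟨ interchange (x ∸ 1) y ((x ∸ 1) ^ length R) (prodQ R) ⟩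
  (x ∸ 1) * y * ((x ∸ 1) ^ length R * prodQ R)
    ≤⟨ *-mono-≤ ([m∸1]*n≤m*[n∸1] x≤y) ([x∸1]^length*prodQ≤x^length*prodQm1 x≤R) ⟩
  x * (y ∸ 1) * (x ^ length R * prodQm1 R)
    ≡⟨ interchange x (y ∸ 1) (x ^ length R) (prodQm1 R) ⟨
  x * x ^ length R * ((y ∸ 1) * prodQm1 R)
    ∎
  where
  open ≤-Reasoning
  interchange : ∀ a b c d → a * c * (b * d) ≡ a * b * (c * d)
  interchange = solve-∀

Exhausted : ℕ → ℕ → ℕ → ℕ → Set
Exhausted n A B x = 3 + 2 * B * x ^ n ≤ 3 * A * (x ∸ 1) ^ n

exhausted? : ∀ n A B x → Dec (Exhausted n A B x)
exhausted? n A B x = 3 + 2 * B * x ^ n ≤? 3 * A * (x ∸ 1) ^ n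

-- Multiplying `Exhausted` by ∏ q and applying the ratio bound gives 3 ∏ q ≤ 2 x^|R| ≤ 2 ∏ q.
exhausted⇒¬Solves : ∀ A B {x R} → 1 ≤ x → All (x ≤_) R → Exhausted (length R) A B x → ¬ Solves A B R
exhausted⇒¬Solves A B {x} {R} 1≤x x≤R exhausted sol =
  ≤⇒≯ (*-cancelʳ-≤ 3 2 P {{>-nonZero (≤-trans 1≤C C≤P)}} (≤-trans 3P≤2C (*-monoʳ-≤ 2 C≤P)))
      ≤-refl
  where
  open ≤-Reasoning
  C E P M : ℕ
  C = x ^ length R
  E = (x ∸ 1) ^ length R
  P = prodQ R
  M = prodQm1 R
  1≤C : 1 ≤ C
  1≤C = m^n>0 x {{>-nonZero 1≤x}} (length R)
  C≤P : C ≤ P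
  C≤P = x^length≤prodQ x≤R
  expandˡ : ∀ b c p → (3 + 2 * b * c) * p ≡ 2 * b * c * p + 3 * p
  expandˡ = solve-∀
  expandʳ : ∀ b c p → c * (2 * b * p + 2) ≡ 2 * b * c * p + 2 * c
  expandʳ = solve-∀
  left-comm : ∀ a c m → a * (c * m) ≡ c * (a * m)
  left-comm = solve-∀
  3P≤2C : 3 * P ≤ 2 * C
  3P≤2C = +-cancelˡ-≤ (2 * B * C * P) _ _ (begin
    2 * B * C * P + 3 * P ≡⟨ expandˡ B C P ⟨
    (3 + 2 * B * C) * P   ≤⟨ *-monoˡ-≤ P exhausted ⟩
    3 * A * E * P         ≡⟨ *-assoc (3 * A) E P ⟩
    3 * A * (E * P)       ≤⟨ *-monoʳ-≤ (3 * A) ([x∸1]^length*prodQ≤x^length*prodQm1 x≤R) ⟩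
    3 * A * (C * M)       ≡⟨ left-comm (3 * A) C M ⟩
    C * (3 * A * M)       ≡⟨ cong (C *_) sol ⟩
    C * (2 * B * P + 2)   ≡⟨ expandʳ B C P ⟩
    2 * B * C * P + 2 * C ∎)

-- A scan for the next entry
-- stops once `Exhausted` holds; one that runs out of fuel first returns
-- `nothing`, of which completeness says nothing (`Listed` holds vacuously).
-- The longest scan needed for the theorem takes about 1300 steps.
mutual
  candidates : ℕ → ℕ → ℕ → ℕ → Maybe (List (List ℕ))
  candidates zero A B x with solves? A B []
  ... | yes _ = just ([] ∷ [])
  ... | no _  = just []
  candidates (suc n) A B x with 3 * A ≤? 2 * B
  ... | yes _ = just []
  ... | no _  = scan n A B x 2000

  scan : ℕ → ℕ → ℕ → ℕ → ℕ → Maybe (List (List ℕ))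
  scan n A B x zero = nothing
  scan n A B x (suc fuel) with exhausted? (suc n) A B x
  ... | yes _ = just []
  ... | no _  = Maybe.zipWith _++_
                  (Maybe.map (map (x ∷_)) (candidates n (A * (x ∸ 1)) (B * x) (suc x)))
                  (scan n A B (suc x) fuel)

Listed : {A : Set} → A → Maybe (List A) → Set
Listed a = MaybeAll.All (a ∈_)

Listed-zipWith-++ˡ : ∀ {A : Set} {a : A} {xs} ys → Listed a xs → Listed a (Maybe.zipWith _++_ xs ys)
Listed-zipWith-++ˡ (just _) (just a∈xs) = just (∈-++⁺ˡ a∈xs)
Listed-zipWith-++ˡ nothing  (just _)    = nothing
Listed-zipWith-++ˡ _        nothing     = nothing

Listed-zipWith-++ʳ : ∀ {A : Set} {a : A} xs {ys} → Listed a ys → Listed a (Maybe.zipWith _++_ xs ys)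
Listed-zipWith-++ʳ (just xs) (just a∈ys) = just (∈-++⁺ʳ xs a∈ys)
Listed-zipWith-++ʳ (just _)  nothing     = nothing
Listed-zipWith-++ʳ nothing   _           = nothing

Listed-map : ∀ {A B : Set} {a : A} (f : A → B) {xs} → Listed a xs → Listed (f a) (Maybe.map (map f) xs)
Listed-map f listed = MaybeAll.map⁺ (MaybeAll.map (∈-map⁺ f) listed)

mutual
  candidates-complete : ∀ n A B {x R} → 1 ≤ x → IncreasingFrom x R → length R ≡ n → Solves A B R →
                        Listed R (candidates n A B x)
  candidates-complete zero A B {R = []} _ _ _ sol with solves? A B []
  ... | yes _   = just (here refl)
  ... | no ¬sol = contradiction sol ¬sol
  candidates-complete (suc n) A B {R = R} 1≤x incr len sol with 3 * A ≤? 2 * B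
  ... | yes 3A≤2B = contradiction sol (3A≤2B⇒¬Solves A B R 3A≤2B)
  ... | no _      = scan-complete n A B 2000 1≤x incr len sol

  scan-complete : ∀ n A B fuel {x R} → 1 ≤ x → IncreasingFrom x R → length R ≡ suc n → Solves A B R →
                  Listed R (scan n A B x fuel)
  scan-complete n A B zero _ _ _ _ = nothing
  scan-complete n A B (suc fuel) {x} {y ∷ R} 1≤x incr@(x≤y ∷ incr′) len sol
    with exhausted? (suc n) A B x
  ... | yes exhausted = contradiction sol
    (exhausted⇒¬Solves A B 1≤x (IncreasingFrom⇒All≤ incr) (subst (λ k → Exhausted k A B x) (sym len) exhausted))
  ... | no _ with m≤n⇒m<n∨m≡n x≤y
  ...   | inj₂ refl = Listed-zipWith-++ˡ (scan n A B (suc x) fuel) (Listed-map (x ∷_)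
                        (candidates-complete n (A * (x ∸ 1)) (B * x) z<s incr′ (suc-injective len)
                          (Solves-∷ A B x R sol)))
  ...   | inj₁ x<y  = Listed-zipWith-++ʳ _ (scan-complete n A B fuel z<s (x<y ∷ incr′) len sol)

increasing-solutions : ∀ {R} → IncreasingFrom 5 R → length R ≡ 4 → Solves 1 1 R →
                       R ≡ Q₀ ⊎ R ≡ 5 ∷ 7 ∷ 49 ∷ 133 ∷ []
increasing-solutions incr len sol with drop-just (candidates-complete 4 1 1 z<s incr len sol)
... | here R≡Q₀            = inj₁ R≡Q₀
... | there (here R≡other) = inj₂ R≡other

prime-increasing-solution : ∀ {R} → All Prime R → IncreasingFrom 5 R → length R ≡ 4 → Solves 1 1 R →
                            R ≡ Q₀
prime-increasing-solution primes incr len sol with increasing-solutions incr len sol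
... | inj₁ R≡Q₀ = R≡Q₀
... | inj₂ refl = contradiction (All.lookup primes (there (there (here refl)))) (from-no (prime? 49))

5≤prime : ∀ {q} → Prime q → q ≢ 2 → q ≢ 3 → 5 ≤ q
5≤prime {0}                             p _   _   = contradiction p ¬prime[0]
5≤prime {1}                             p _   _   = contradiction p ¬prime[1]
5≤prime {2}                             _ q≢2 _   = contradiction refl q≢2
5≤prime {3}                             _ _   q≢3 = contradiction refl q≢3
5≤prime {4}                             p _   _   = contradiction composite[4] (Prime.notComposite p)
5≤prime {suc (suc (suc (suc (suc _))))} _ _   _   = s≤s (s≤s (s≤s (s≤s (s≤s z≤n))))

5≤primes : ∀ {Q} → All Prime Q → 2 ∉ Q → 3 ∉ Q → All (5 ≤_) Q
5≤primes primes 2∉Q 3∉Q = All.tabulate (λ q∈Q →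
  5≤prime (All.lookup primes q∈Q) (λ { refl → 2∉Q q∈Q }) (λ { refl → 3∉Q q∈Q }))

+m-+n≡+o⇒m≡n+o : ∀ m n o → + m ℤ.- + n ≡ + o → m ≡ n + o
+m-+n≡+o⇒m≡n+o m n o eq = ℤ.+-injective (begin
  + m                  ≡⟨ //-rightDividesˡ (+ n) (+ m) ⟨
  (+ m ℤ.- + n) ℤ.+ + n ≡⟨ cong (ℤ._+ + n) eq ⟩
  + o ℤ.+ + n          ≡⟨ ℤ.+-comm (+ o) (+ n) ⟩
  + n ℤ.+ + o          ≡⟨ ℤ.pos-+ n o ⟨
  + (n + o)            ∎)
  where open ≡-Reasoning

Eqn⇒Solves : ∀ Q → Eqn Q → Solves 1 1 Q
Eqn⇒Solves Q eqn = +m-+n≡+o⇒m≡n+o (3 * prodQm1 Q) (2 * prodQ Q) 2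
  (subst₂ (λ a b → a ℤ.- b ≡ + 2) (sym (ℤ.pos-* 3 (prodQm1 Q))) (sym (ℤ.pos-* 2 (prodQ Q))) eqn)

lemma9 : ((Q : List ℕ) → All Prime Q → Unique Q → 2 ∉ Q → 3 ∉ Q → length Q ≡ 4
           → Eqn Q → (Q ↭ Q₀) × (prodQ Q ≡ 5 * 7 * 37 * 1297))
         × (All Prime Q₀ × Unique Q₀ × 2 ∉ Q₀ × 3 ∉ Q₀ × length Q₀ ≡ 4 × Eqn Q₀)
lemma9 = only-solution
       , ( from-yes (all? prime? Q₀) , from-yes (unique? Q₀) , from-no (2 ∈? Q₀) , from-no (3 ∈? Q₀)
         , refl , refl )
  where
  only-solution : (Q : List ℕ) → All Prime Q → Unique Q → 2 ∉ Q → 3 ∉ Q → length Q ≡ 4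
                  → Eqn Q → (Q ↭ Q₀) × (prodQ Q ≡ 5 * 7 * 37 * 1297)
  only-solution Q primes unique 2∉Q 3∉Q len eqn = subst (Q ↭_) sorted≡Q₀ Q↭sorted
                                               , trans (product-↭ Q↭sorted) (cong prodQ sorted≡Q₀)
    where
    Q↭sorted : Q ↭ sort Q
    Q↭sorted = ↭-sym (sort-↭ Q)
    sorted≡Q₀ : sort Q ≡ Q₀
    sorted≡Q₀ = prime-increasing-solution (All-resp-↭ Q↭sorted primes)
                  (sort-increasing Q (5≤primes primes 2∉Q 3∉Q) unique) (trans (↭-length (sort-↭ Q)) len)
                  (Solves-resp-↭ 1 1 Q↭sorted (Eqn⇒Solves Q eqn))
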